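{- Let $a$ be a positive integer and let $m\in\mathbb{Z}_{\geq 2}\setminus\{3,\,2a+4,\,4a+5\}$, where in the case $a=1$ additionally $m\ne 12$. With $$f_{m,a}(r)=\frac{1}{(1+a)^r}\sum_{i=0}^{r}\binom{m}{i}a^i,\qquad r_a=\Big\lfloor\frac{am-(a-1)}{2a+1}\Big\rfloor+1,$$ we have $f_{m,a}(r_a-1)<f_{m,a}(r_a)$. -}

module Defs where

open import Data.Nat as ℕ using (ℕ; suc; _+_; _*_; _∸_; _^_; _/_; NonZero)
open import Data.Nat.Properties using (m^n≢0; +-comm)
open import Data.Nat.Combinatorics using (_C_)
open import Data.Integer using (+_)
open import Data.Rational as ℚ using (ℚ)

partialSum : (m a r : ℕ) → ℕ
partialSum m a ℕ.zero    = (m C 0) * a ^ 0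
partialSum m a (suc r) = partialSum m a r + (m C suc r) * a ^ suc r

f : (m a r : ℕ) → ℚ
f m a r = ℚ._/_ (+ partialSum m a r) ((1 + a) ^ r) {{m^n≢0 (1 + a) r}}

-- r_a = ⌊(a m - (a - 1)) / (2a+1)⌋ + 1   (numerator nonnegative for a ≥ 1, m ≥ 2)
rₐ : (m a : ℕ) → ℕ
rₐ m a = ((a * m ∸ (a ∸ 1)) / (2 * a + 1)) {{nz}} + 1
  where
  nz : NonZero (2 * a + 1)
  nz rewrite +-comm (2 * a) 1 = _

{-# OPTIONS --safe #-}

-- With Tᵢ = C(m,i)·aⁱ and S_k = T₀ + … + T_k we have f(k+1)/f(k) = (S_k + T_{k+1})/((1+a)·S_k), so
-- the claim is a·S_k < T_{k+1} for k = rₐ − 1 = ⌊(am − a + 1)/(2a + 1)⌋ (Rises). Write m = 2k + 1 + e;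
-- the division by 2a + 1 leaves a remainder s with a·e = s + k − 1. Below k − 1 the ratios
-- T_{i+1}/Tᵢ = a(m − i)/(i + 1) are at least a(n + 2)/(k − 1), where n = m − k, so S_{k−1} is dominated
-- by a geometric series ending in T_{k−1}; with the exact ratios T_k/T_{k−1} and T_{k+1}/T_k the
-- claim reduces to a polynomial inequality in e, k and s (Margin). It holds whenever s > 0; for s = 0
-- it says (e − 2)(k − 3) > 12, which fails for e ≤ 2 (m = 3, 2a + 4, 4a + 5), for a = 1, e = 3
-- (m = 12), and in six further cases where the claim is checked by evaluation.
module Submission where

open import Data.Empty using (⊥-elim)
open import Data.Integer as ℤ using (+_)
import Data.Integer.Properties as ℤ
open import Data.List using (_∷_; [])
open import Data.Nat
open import Data.Nat.Combinatorics using (_C_; nC1≡n; nCk+nC[k+1]≡[n+1]C[k+1])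
open import Data.Nat.DivMod using (m≡m%n+[m/n]*n)
open import Data.Nat.Properties
open import Data.Nat.Tactic.RingSolver using (solve-∀; solve)
open import Data.Product using (_×_; _,_; ∃-syntax; uncurry)
import Data.Rational as ℚ
open import Data.Rational.Properties using (toℚᵘ-cancel-<; toℚᵘ-fromℚᵘ)
import Data.Rational.Unnormalised as ℚᵘ
import Data.Rational.Unnormalised.Properties as ℚᵘ
open import Data.Sum using (_⊎_; inj₁; inj₂; [_,_]′)
open import Relation.Nullary using (¬_)
open import Relation.Binary.PropositionalEquality

open import Defs

term : ℕ → ℕ → ℕ → ℕ
term m a i = (m C i) * a ^ i

Rises : ℕ → ℕ → ℕ → Set
Rises m a k = a * partialSum m a k < term m a (suc k)

+p/q<+r/s : ∀ p q r s .{{_ : NonZero q}} .{{_ : NonZero s}} → p * s < r * q → (+ p) ℚ./ q ℚ.< (+ r) ℚ./ s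
+p/q<+r/s p zero r s _ = ⊥-elim (≢-nonZero⁻¹ 0 refl)
+p/q<+r/s p (suc q) r zero _ = ⊥-elim (≢-nonZero⁻¹ 0 refl)
+p/q<+r/s p (suc q) r (suc s) ps<rq =
  toℚᵘ-cancel-< (ℚᵘ.<-respˡ-≃ (ℚᵘ.≃-sym (toℚᵘ-fromℚᵘ p/q)) (ℚᵘ.<-respʳ-≃ (ℚᵘ.≃-sym (toℚᵘ-fromℚᵘ r/s))
    (ℚᵘ.*<* (subst₂ ℤ._<_ (ℤ.pos-* p (suc s)) (ℤ.pos-* r (suc q)) (ℤ.+<+ ps<rq)))))
  where
  p/q = ℚᵘ.mkℚᵘ (+ p) q
  r/s = ℚᵘ.mkℚᵘ (+ r) s

f-rises : ∀ m a k → Rises m a k → f m a k ℚ.< f m a (suc k)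
f-rises m a k rises =
  +p/q<+r/s S P (S + term m a (suc k)) ((1 + a) * P) {{P≢0}} {{m^n≢0 (1 + a) (suc k)}} (begin-strict
    S * ((1 + a) * P)          ≡⟨ distribute S a P ⟩
    (S + a * S) * P            <⟨ *-monoˡ-< P (+-monoʳ-< S rises) ⟩
    (S + term m a (suc k)) * P ∎)
  where
  open ≤-Reasoning
  S = partialSum m a k
  P = (1 + a) ^ k
  instance
    P≢0 : NonZero P
    P≢0 = m^n≢0 (1 + a) k
  distribute : ∀ x y z → x * ((1 + y) * z) ≡ (x + y * x) * z
  distribute = solve-∀

[k+1]*mC[k+1]+k*mCk≡m*mCk : ∀ m k → suc k * (m C suc k) + k * (m C k) ≡ m * (m C k)
[k+1]*mC[k+1]+k*mCk≡m*mCk zero    zero    = refl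
[k+1]*mC[k+1]+k*mCk≡m*mCk zero    (suc k) = cong₂ _+_ (*-zeroʳ (2 + k)) (*-zeroʳ (suc k))
[k+1]*mC[k+1]+k*mCk≡m*mCk (suc m) zero    = begin
  1 * (suc m C 1) + 0 ≡⟨ cong (λ c → 1 * c + 0) (nC1≡n (suc m)) ⟩
  1 * suc m + 0       ≡⟨ solve (m ∷ []) ⟩
  suc m * 1           ∎
  where open ≡-Reasoning
[k+1]*mC[k+1]+k*mCk≡m*mCk (suc m) (suc k) = begin
  (2 + k) * (suc m C (2 + k)) + suc k * (suc m C suc k)
    ≡⟨ cong₂ (λ c c′ → (2 + k) * c + suc k * c′) (sym (nCk+nC[k+1]≡[n+1]C[k+1] m (suc k))) (sym (pascal k)) ⟩
  (2 + k) * (y + z) + suc k * (x + y)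
    ≡⟨ regroup k x y z ⟩
  (suc k * y + k * x) + ((2 + k) * z + suc k * y) + (x + y)
    ≡⟨ cong₂ (λ p q → p + q + (x + y)) ([k+1]*mC[k+1]+k*mCk≡m*mCk m k) ([k+1]*mC[k+1]+k*mCk≡m*mCk m (suc k)) ⟩
  m * x + m * y + (x + y)
    ≡⟨ collect m x y ⟩
  suc m * (x + y)
    ≡⟨ cong (suc m *_) (pascal k) ⟩
  suc m * (suc m C suc k) ∎
  where
  open ≡-Reasoning
  pascal = nCk+nC[k+1]≡[n+1]C[k+1] m
  x = m C k
  y = m C suc k
  z = m C (2 + k)
  regroup : ∀ k x y z → (2 + k) * (y + z) + suc k * (x + y) ≡ (suc k * y + k * x) + ((2 + k) * z + suc k * y) + (x + y)
  regroup = solve-∀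
  collect : ∀ m x y → m * x + m * y + (x + y) ≡ suc m * (x + y)
  collect = solve-∀

[k+1]*mC[k+1]≡[m∸k]*mCk : ∀ m k → suc k * (m C suc k) ≡ (m ∸ k) * (m C k)
[k+1]*mC[k+1]≡[m∸k]*mCk m k = begin
  suc k * (m C suc k)                           ≡⟨ m+n∸n≡m _ (k * (m C k)) ⟨
  suc k * (m C suc k) + k * (m C k) ∸ k * (m C k) ≡⟨ cong (_∸ k * (m C k)) ([k+1]*mC[k+1]+k*mCk≡m*mCk m k) ⟩
  m * (m C k) ∸ k * (m C k)                      ≡⟨ *-distribʳ-∸ (m C k) m k ⟨
  (m ∸ k) * (m C k)                             ∎
  where open ≡-Reasoning

mCk>0 : ∀ {m k} → k ≤ m → 0 < m C k
mCk>0 {k = zero}  _          = z<s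
mCk>0 {suc m} {suc k} (s≤s k≤m) =
  subst (0 <_) (nCk+nC[k+1]≡[n+1]C[k+1] m k) (<-≤-trans (mCk>0 k≤m) (m≤m+n _ _))

[i+1]*term[i+1]≡a*[m∸i]*term[i] : ∀ m a i → suc i * term m a (suc i) ≡ a * (m ∸ i) * term m a i
[i+1]*term[i+1]≡a*[m∸i]*term[i] m a i = begin
  suc i * ((m C suc i) * (a * a ^ i)) ≡⟨ *-assoc (suc i) (m C suc i) (a * a ^ i) ⟨
  suc i * (m C suc i) * (a * a ^ i)   ≡⟨ cong (_* (a * a ^ i)) ([k+1]*mC[k+1]≡[m∸k]*mCk m i) ⟩
  (m ∸ i) * (m C i) * (a * a ^ i)     ≡⟨ rearrange (m ∸ i) (m C i) a (a ^ i) ⟩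
  a * (m ∸ i) * ((m C i) * a ^ i)     ∎
  where
  open ≡-Reasoning
  rearrange : ∀ x y z w → x * y * (z * w) ≡ z * x * (y * w)
  rearrange = solve-∀

term>0 : ∀ {m i} a .{{_ : NonZero a}} → i ≤ m → 0 < term m a i
term>0 {i = i} a i≤m = *-mono-< (mCk>0 i≤m) (m^n>0 a i)

a*q*term[i]≤p*term[i+1] : ∀ m a {i p q} → q ≤ m ∸ i → suc i ≤ p → a * q * term m a i ≤ p * term m a (suc i)
a*q*term[i]≤p*term[i+1] m a {i} {p} {q} q≤m∸i i<p = begin
  a * q * term m a i       ≤⟨ *-monoˡ-≤ (term m a i) (*-monoʳ-≤ a q≤m∸i) ⟩
  a * (m ∸ i) * term m a i ≡⟨ [i+1]*term[i+1]≡a*[m∸i]*term[i] m a i ⟨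
  suc i * term m a (suc i) ≤⟨ *-monoˡ-≤ (term m a (suc i)) i<p ⟩
  p * term m a (suc i)     ∎
  where open ≤-Reasoning

partialSum-geometric : ∀ m a p d j → (∀ i → i < j → (p + d) * term m a i ≤ p * term m a (suc i)) →
                       d * partialSum m a j ≤ (p + d) * term m a j
partialSum-geometric m a p d zero    _      = *-monoˡ-≤ (term m a 0) (m≤n+m d p)
partialSum-geometric m a p d (suc j) growth = begin
  d * (partialSum m a j + term m a (suc j))       ≡⟨ *-distribˡ-+ d (partialSum m a j) _ ⟩
  d * partialSum m a j + d * term m a (suc j)     ≤⟨ +-monoˡ-≤ _ (partialSum-geometric m a p d j growth′) ⟩
  (p + d) * term m a j + d * term m a (suc j)     ≤⟨ +-monoˡ-≤ _ (growth j ≤-refl) ⟩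
  p * term m a (suc j) + d * term m a (suc j)     ≡⟨ *-distribʳ-+ _ p d ⟨
  (p + d) * term m a (suc j)                      ∎
  where
  open ≤-Reasoning
  growth′ : ∀ i → i < j → (p + d) * term m a i ≤ p * term m a (suc i)
  growth′ i i<j = growth i (m<n⇒m<1+n i<j)

-- S is the partial sum up to k − 1, and t, Y, X are the terms at k − 1, k, k + 1 of row n + k.
a*[S+Y]<X : ∀ {a n k D e S t Y X} → 0 < X → n ≡ e + suc k →
            a * n * Y ≡ suc k * X → a * suc n * t ≡ k * Y → D * S ≤ a * (n + 2) * t →
            (n + 2) * k * suc k < suc n * (D * e) → a * (S + Y) < X
a*[S+Y]<X {a} {n} {k} {D} {e} {S} {t} {Y} {X} X>0 n≡ ratio-n ratio-n+1 DS≤ margin =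
  *-cancelˡ-< (suc n * D * n) _ _ (begin-strict
    suc n * D * n * (a * (S + Y))
      ≡⟨ solve (a ∷ n ∷ D ∷ S ∷ Y ∷ []) ⟩
    n * a * (suc n * (D * S)) + suc n * D * (a * n * Y)
      ≤⟨ +-monoˡ-≤ _ (*-monoʳ-≤ (n * a) S-bound) ⟩
    n * a * ((n + 2) * (k * Y)) + suc n * D * (a * n * Y)
      ≡⟨ solve (a ∷ n ∷ k ∷ D ∷ Y ∷ []) ⟩
    ((n + 2) * k + suc n * D) * (a * n * Y)
      ≡⟨ cong (((n + 2) * k + suc n * D) *_) ratio-n ⟩
    ((n + 2) * k + suc n * D) * (suc k * X)
      ≡⟨ solve (n ∷ k ∷ D ∷ X ∷ []) ⟩
    (n + 2) * k * suc k * X + suc n * D * suc k * X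
      <⟨ +-monoˡ-< _ (*-monoˡ-< X margin) ⟩
    suc n * (D * e) * X + suc n * D * suc k * X
      ≡⟨ solve (n ∷ k ∷ D ∷ e ∷ X ∷ []) ⟩
    suc n * D * (e + suc k) * X
      ≡⟨ cong (λ x → suc n * D * x * X) n≡ ⟨
    suc n * D * n * X ∎)
  where
  open ≤-Reasoning
  instance _ = >-nonZero X>0
  S-bound : suc n * (D * S) ≤ (n + 2) * (k * Y)
  S-bound = begin
    suc n * (D * S)             ≤⟨ *-monoʳ-≤ (suc n) DS≤ ⟩
    suc n * (a * (n + 2) * t)   ≡⟨ solve (a ∷ n ∷ t ∷ []) ⟩
    (n + 2) * (a * suc n * t)   ≡⟨ cong ((n + 2) *_) ratio-n+1 ⟩
    (n + 2) * (k * Y)           ∎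

-- The inequality left by a*[S+Y]<X, where n = m − k and D = s + a(k + 3); D·e has been expanded
-- with a·e = s + k′ so that a no longer occurs.
Margin : ℕ → ℕ → ℕ → Set
Margin e k′ s = (n + 2) * k * suc k < suc n * ((k + 3) * (s + k′) + s * e)
  where
  k = suc k′
  n = e + suc k

margin-pos-remainder : ∀ e k′ s → Margin e k′ (suc s)
margin-pos-remainder e k′ s = begin-strict
  (n + 2) * k * suc k                        <⟨ m<m+n _ z<s ⟩
  (n + 2) * k * suc k + (k + 3 + 2 * e) * k  ≡⟨ widen e k′ ⟩
  suc n * ((k + 3) * k)                      ≤⟨ *-monoʳ-≤ (suc n) [k+3]k≤ ⟩
  suc n * ((k + 3) * (suc s + k′) + suc s * e) ∎
  where
  open ≤-Reasoning
  k = suc k′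
  n = e + suc k
  [k+3]k≤ : (k + 3) * k ≤ (k + 3) * (suc s + k′) + suc s * e
  [k+3]k≤ = ≤-trans (*-monoʳ-≤ (k + 3) (s≤s (m≤n+m k′ s))) (m≤m+n _ _)
  widen : ∀ e k′ → let k = suc k′; n = e + suc k in
          (n + 2) * k * suc k + (k + 3 + 2 * e) * k ≡ suc n * ((k + 3) * k)
  widen = solve-∀

margin-zero-remainder : ∀ u v → 12 < u * v → Margin (2 + u) (2 + v) 0
margin-zero-remainder u v 12<uv =
  +-cancelʳ-< 12 _ _ (<-≤-trans (+-monoʳ-< _ 12<uv) (≤-reflexive (surplus u v)))
  where
  surplus : ∀ u v → let e = 2 + u; k′ = 2 + v; k = suc k′; n = e + suc k in
            (n + 2) * k * suc k + u * v ≡ suc n * ((k + 3) * (0 + k′) + 0 * e) + 12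
  surplus = solve-∀

rises-if-margin : ∀ a .{{_ : NonZero a}} e k′ s → let k = suc k′ in
                  a * e ≡ s + k′ → Margin e k′ s → Rises (e + (suc k + k)) a k
rises-if-margin a e k′ s ae≡s+k′ margin =
  a*[S+Y]<X {a} {n} {k} {D} {e} {partialSum m a k′} {term m a k′} {term m a k} {term m a (suc k)}
    (term>0 a k+1≤m) refl ratio-at-k ratio-at-k′ geometric margin′
  where
  k = suc k′
  n = e + suc k
  m = e + (suc k + k)
  D = s + a * (k + 3)
  m≡n+k : m ≡ n + k
  m≡n+k = sym (+-assoc e (suc k) k)
  k+1≤m : suc k ≤ m
  k+1≤m = ≤-trans (m≤m+n (suc k) k) (m≤n+m _ e)
  ratio-at-k : a * n * term m a k ≡ suc k * term m a (suc k)
  ratio-at-k = sym (trans ([i+1]*term[i+1]≡a*[m∸i]*term[i] m a k)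
                          (cong (λ x → a * x * term m a k) (trans (cong (_∸ k) m≡n+k) (m+n∸n≡m n k))))
  ratio-at-k′ : a * suc n * term m a k′ ≡ k * term m a k
  ratio-at-k′ = sym (trans ([i+1]*term[i+1]≡a*[m∸i]*term[i] m a k′)
                           (cong (λ x → a * x * term m a k′)
                                 (trans (cong (_∸ k′) (trans m≡n+k (+-suc n k′))) (m+n∸n≡m (suc n) k′))))
  k′+D≡ : k′ + D ≡ a * (n + 2)
  k′+D≡ = begin
    k′ + (s + a * (suc k′ + 3))  ≡⟨ solve (k′ ∷ s ∷ a ∷ []) ⟩
    s + k′ + a * (suc k′ + 3)    ≡⟨ cong (_+ a * (suc k′ + 3)) ae≡s+k′ ⟨
    a * e + a * (suc k′ + 3)     ≡⟨ solve (a ∷ e ∷ k′ ∷ []) ⟩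
    a * (e + suc (suc k′) + 2)   ∎
    where open ≡-Reasoning
  growth : ∀ i → i < k′ → (k′ + D) * term m a i ≤ k′ * term m a (suc i)
  growth i i<k′ = subst (λ x → x * term m a i ≤ k′ * term m a (suc i)) (sym k′+D≡)
                        (a*q*term[i]≤p*term[i+1] m a (m+n≤o⇒m≤o∸n (n + 2) n+2+i≤m) i<k′)
    where
    open ≤-Reasoning
    n+2+i≤m : n + 2 + i ≤ m
    n+2+i≤m = begin
      n + 2 + i         ≡⟨ +-assoc n 2 i ⟩
      n + suc (suc i)   ≤⟨ +-monoʳ-≤ n (s≤s i<k′) ⟩
      n + k             ≡⟨ m≡n+k ⟨
      m                 ∎
  geometric : D * partialSum m a k′ ≤ a * (n + 2) * term m a k′
  geometric = subst (λ x → D * partialSum m a k′ ≤ x * term m a k′) k′+D≡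
                    (partialSum-geometric m a k′ D k′ growth)
  D*e≡ : D * e ≡ (k + 3) * (s + k′) + s * e
  D*e≡ = begin
    (s + a * (suc k′ + 3)) * e          ≡⟨ solve (s ∷ a ∷ k′ ∷ e ∷ []) ⟩
    (suc k′ + 3) * (a * e) + s * e      ≡⟨ cong (λ x → (suc k′ + 3) * x + s * e) ae≡s+k′ ⟩
    (suc k′ + 3) * (s + k′) + s * e     ∎
    where open ≡-Reasoning
  margin′ : (n + 2) * k * suc k < suc n * (D * e)
  margin′ = subst (λ x → (n + 2) * k * suc k < suc n * x) (sym D*e≡) margin

Exceptional : ℕ → ℕ → Set
Exceptional a m = m ≡ 3 ⊎ m ≡ 2 * a + 4 ⊎ m ≡ 4 * a + 5 ⊎ (a ≡ 1 × m ≡ 12)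

-- The margin fails for (a, e) = (2,3), (3,3), (4,3), (1,4), (2,4), (1,5), where the claim is evaluated.
rises-zero-remainder : ∀ b e → let a = suc b; k = suc (a * e) in
                       ¬ Exceptional a (e + (suc k + k)) → Rises (e + (suc k + k)) a k
rises-zero-remainder b 0 ¬exc = ⊥-elim (¬exc (inj₁ (solve (b ∷ []))))
rises-zero-remainder b 1 ¬exc = ⊥-elim (¬exc (inj₂ (inj₁ (solve (b ∷ [])))))
rises-zero-remainder b 2 ¬exc = ⊥-elim (¬exc (inj₂ (inj₂ (inj₁ (solve (b ∷ []))))))
rises-zero-remainder 0 3 ¬exc = ⊥-elim (¬exc (inj₂ (inj₂ (inj₂ (refl , refl)))))
rises-zero-remainder 1 3 _ = <ᵇ⇒< _ _ _
rises-zero-remainder 2 3 _ = <ᵇ⇒< _ _ _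
rises-zero-remainder 3 3 _ = <ᵇ⇒< _ _ _
rises-zero-remainder (suc (suc (suc (suc c)))) 3 _ =
  rises-if-margin (5 + c) 3 _ 0 refl (margin-zero-remainder 1 (13 + c * 3)
    (<-≤-trans (<ᵇ⇒< 12 13 _) (*-monoʳ-≤ 1 (m≤m+n 13 (c * 3)))))
rises-zero-remainder 0 4 _ = <ᵇ⇒< _ _ _
rises-zero-remainder 1 4 _ = <ᵇ⇒< _ _ _
rises-zero-remainder (suc (suc c)) 4 _ =
  rises-if-margin (3 + c) 4 _ 0 refl (margin-zero-remainder 2 (10 + c * 4)
    (<-≤-trans (<ᵇ⇒< 12 14 _) (*-monoʳ-≤ 2 (m≤m+n 7 (3 + c * 4)))))
rises-zero-remainder 0 5 _ = <ᵇ⇒< _ _ _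
rises-zero-remainder (suc c) 5 _ =
  rises-if-margin (2 + c) 5 _ 0 refl (margin-zero-remainder 3 (8 + c * 5)
    (<-≤-trans (<ᵇ⇒< 12 15 _) (*-monoʳ-≤ 3 (m≤m+n 5 (3 + c * 5)))))
rises-zero-remainder b (suc (suc (suc (suc (suc (suc j)))))) _ =
  rises-if-margin (suc b) (6 + j) _ 0 refl (margin-zero-remainder (4 + j) (4 + j + b * (6 + j))
    (<-≤-trans (<ᵇ⇒< 12 16 _) (*-mono-≤ (m≤m+n 4 j) (m≤m+n 4 (j + b * (6 + j))))))

rises-by-remainder : ∀ b e k′ s → let a = suc b; k = suc k′ in
                     a * e ≡ s + k′ → ¬ Exceptional a (e + (suc k + k)) → Rises (e + (suc k + k)) a k
rises-by-remainder b e k′ (suc s) ae≡s+k′ _ =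
  rises-if-margin (suc b) e k′ (suc s) ae≡s+k′ (margin-pos-remainder e k′ s)
rises-by-remainder b e _ zero refl ¬exc = rises-zero-remainder b e ¬exc

rises-at-0 : ∀ m a .{{_ : NonZero a}} → 2 ≤ m → Rises m a 0
rises-at-0 m a 2≤m = begin-strict
  a * 1             ≡⟨ *-identityˡ (a * 1) ⟨
  1 * (a * 1)       <⟨ *-monoˡ-< (a * 1) 2≤m ⟩
  m * (a * 1)       ≡⟨ cong (_* (a * 1)) (nC1≡n m) ⟨
  (m C 1) * (a * 1) ∎
  where
  open ≤-Reasoning
  instance _ = m*n≢0 a 1

a*m≡x+a*y⇒∃e : ∀ a .{{_ : NonZero a}} {m x y} → a * m ≡ x + a * y → ∃[ e ] a * e ≡ x × m ≡ e + y
a*m≡x+a*y⇒∃e a {m} {x} {y} am≡x+ay = m ∸ y , a[m∸y]≡x , sym (m∸n+n≡m y≤m)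
  where
  open ≡-Reasoning
  y≤m : y ≤ m
  y≤m = *-cancelˡ-≤ a (subst (a * y ≤_) (sym am≡x+ay) (m≤n+m (a * y) x))
  a[m∸y]≡x : a * (m ∸ y) ≡ x
  a[m∸y]≡x = begin
    a * (m ∸ y)         ≡⟨ *-distribˡ-∸ a m y ⟩
    a * m ∸ a * y       ≡⟨ cong (_∸ a * y) am≡x+ay ⟩
    x + a * y ∸ a * y   ≡⟨ m+n∸n≡m x (a * y) ⟩
    x                   ∎

rises-by-division : ∀ b m q s → suc b * m ≡ s + q * (2 * suc b + 1) + b → 2 ≤ m →
                    ¬ Exceptional (suc b) m → Rises m (suc b) q
rises-by-division b m zero     s _     2≤m _ = rises-at-0 m (suc b) 2≤m
rises-by-division b m (suc k′) s am≡ _ ¬exc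
  with a*m≡x+a*y⇒∃e (suc b) {x = s + k′} {y = suc (suc k′) + suc k′} (trans am≡ (solve (s ∷ k′ ∷ b ∷ [])))
... | e , ae≡s+k′ , refl = rises-by-remainder b e k′ s ae≡s+k′ ¬exc

a*m≡r+q*[2a+1]+b : ∀ b m .{{_ : NonZero m}} → let a = suc b; N = a * m ∸ b; d = 2 * a + 1 in
                   a * m ≡ N % d + N / d * d + b
a*m≡r+q*[2a+1]+b b m = begin
  suc b * m                     ≡⟨ m∸n+n≡m (≤-trans (n≤1+n b) (m≤m*n (suc b) m)) ⟨
  N + b                         ≡⟨ cong (_+ b) (m≡m%n+[m/n]*n N d) ⟩
  N % d + N / d * d + b         ∎
  where
  open ≡-Reasoning
  N = suc b * m ∸ b
  d = 2 * suc b + 1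

rₐ≡1+q : ∀ b m → rₐ m (suc b) ≡ suc ((suc b * m ∸ b) / (2 * suc b + 1))
rₐ≡1+q b m = +-comm _ 1

proposition3p1 : (a m : ℕ) → 1 ≤ a → 2 ≤ m → m ≢ 3 → m ≢ 2 * a + 4 → m ≢ 4 * a + 5 → (a ≡ 1 → m ≢ 12) →
    f m a (rₐ m a ∸ 1) ℚ.< f m a (rₐ m a)
proposition3p1 zero    _ () _ _ _ _ _
proposition3p1 (suc b) m _ 2≤m m≢3 m≢2a+4 m≢4a+5 m≢12 rewrite rₐ≡1+q b m =
  f-rises m a q (rises-by-division b m q (N % d) (a*m≡r+q*[2a+1]+b b m {{m≢0}}) 2≤m
    [ m≢3 , [ m≢2a+4 , [ m≢4a+5 , uncurry m≢12 ]′ ]′ ]′)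
  where
  a = suc b
  N = a * m ∸ b
  d = 2 * a + 1
  q = N / d
  m≢0 = >-nonZero (≤-trans (s≤s z≤n) 2≤m)
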